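{- Let $E$ be a set of straight clauses and let $H$ be a clause with guard literal whose signed relation name is $P$, such that $H \vdash E$. Then for every literal $Q(x_1,\dots,x_n) \in H$ and every $1 \leq i \leq n$: if $x_i = \pi^H_{P,j}$, then $j \in S^E_{P,Q,i}$.
   Context: Clauses are finite disjunctions of first-order literals, treated as sets of literals. A signed relation name is a relation name together with the polarity (positive/negative) of a literal in which it occurs. A clause is straight if no signed relation name occurs in it twice. $\phi \vdash \psi$ ($\theta$-subsumption) means there is a variable substitution $\theta$ with $\phi\theta \subseteq \psi$; $H \vdash E$ means $H \vdash C$ for all $C \in E$. A literal $G \in H$ is a guard of $H$ if every variable of $H$ occurs in $G$. For a clause $C$ in which the signed relation name $P$ occurs exactly once, $\pi^C_{P,i}$ denotes the term at position $i$ of that literal; $\pi^H_{P,j}$ denotes the term at position $j$ of the guard literal of $H$. For a straight clause $C$ containing signed relation names $P$ and $Q$, the relative shield of position $i$ of $Q$ by $P$ in $C$ is $S^C_{P,Q,i} = \{ j \mid \pi^C_{P,j} = \pi^C_{Q,i}\}$; for a set $E$ of straight clauses all containing $P$ and $Q$, $S^E_{P,Q,i} = \bigcap_{C \in E} S^C_{P,Q,i}$. -}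

module Defs where

open import Data.Nat using (ℕ; zero; suc)
open import Data.Bool using (Bool)
open import Data.List using (List; []; _∷_)
open import Data.List.Membership.Propositional using (_∈_)
open import Data.List.Relation.Unary.Any using (Any)
open import Data.Maybe using (Maybe; just; nothing)
open import Data.Product using (_×_; _,_; ∃-syntax)
open import Relation.Binary.PropositionalEquality using (_≡_)

Var : Set
Var = ℕ

data Term : Set where
  var : Var → Term
  fn  : ℕ → List Term → Term

-- A signed relation name: polarity (true = positive) together with a relation name.
SignedRel : Set
SignedRel = Bool × ℕ

record Literal : Set where
  constructor lit
  field
    sign : Bool
    rel  : ℕ
    args : List Term
open Literal public

sname : Literal → SignedRel
sname L = sign L , rel L

-- Clauses are finite sets of literals, represented by lists (membership = _∈_).
Clause : Set
Clause = List Literal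

-- Term at (1-based) position i of an argument list.
_at_ : List Term → ℕ → Maybe Term
[]       at _           = nothing
(t ∷ ts) at zero        = nothing
(t ∷ ts) at suc zero    = just t
(t ∷ ts) at suc (suc i) = ts at suc i

Subst : Set
Subst = Var → Term

mutual
  substT : Subst → Term → Term
  substT θ (var x)  = θ x
  substT θ (fn f ts) = fn f (substTs θ ts)

  substTs : Subst → List Term → List Term
  substTs θ []       = []
  substTs θ (t ∷ ts) = substT θ t ∷ substTs θ ts

substL : Subst → Literal → Literal
substL θ (lit s r ts) = lit s r (substTs θ ts)

_⊢_ : Clause → Clause → Set
φ ⊢ ψ = ∃[ θ ] (∀ {L} → L ∈ φ → substL θ L ∈ ψ)

_⊢ˢ_ : Clause → (Clause → Set) → Set
H ⊢ˢ E = ∀ C → E C → H ⊢ C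

mutual
  data OccT (x : Var) : Term → Set where
    here : OccT x (var x)
    inFn : ∀ {f ts} → OccTs x ts → OccT x (fn f ts)

  data OccTs (x : Var) : List Term → Set where
    hd : ∀ {t ts} → OccT x t → OccTs x (t ∷ ts)
    tl : ∀ {t ts} → OccTs x ts → OccTs x (t ∷ ts)

OccL : Var → Literal → Set
OccL x L = OccTs x (args L)

OccC : Var → Clause → Set
OccC x C = Any (OccL x) C

Guard : Clause → Literal → Set
Guard H G = G ∈ H × (∀ x → OccC x H → OccL x G)

Straight : Clause → Set
Straight C = ∀ {L M} → L ∈ C → M ∈ C → sname L ≡ sname M → L ≡ M

-- j ∈ S^C_{P,Q,i}: the (unique, by straightness) literals of C with signed
-- names P and Q satisfy π^C_{P,j} = π^C_{Q,i} (both positions defined).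
InShield : Clause → SignedRel → SignedRel → ℕ → ℕ → Set
InShield C P Q i j =
  ∃[ L ] ∃[ M ] ∃[ t ]
    (L ∈ C × M ∈ C × sname L ≡ P × sname M ≡ Q ×
     args L at j ≡ just t × args M at i ≡ just t)

InShieldˢ : (Clause → Set) → SignedRel → SignedRel → ℕ → ℕ → Set
InShieldˢ E P Q i j = ∀ C → E C → InShield C P Q i j

-- A substitution θ with Hθ ⊆ C sends G and Q to literals Gθ, Qθ of C with the
-- same signed names, and substitution commutes with reading off an argument, so
-- the shared argument x becomes the shared argument xθ. Straightness of the
-- clauses of E is unused: it only makes Gθ and Qθ the unique literals of C with
-- those names, which the existential InShield does not require.
module Submission where

open import Defs
open import Data.Nat using (ℕ; zero; suc)
open import Data.Maybe using (just)
open import Data.Product using (_,_; proj₁)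
open import Data.List using (List; []; _∷_)
open import Data.List.Membership.Propositional using (_∈_)
open import Relation.Binary.PropositionalEquality using (_≡_; refl)

at-substTs : (θ : Subst) (ts : List Term) (i : ℕ) {x : Term} →
             ts at i ≡ just x → substTs θ ts at i ≡ just (substT θ x)
at-substTs θ (t ∷ ts) (suc zero)    refl = refl
at-substTs θ (t ∷ ts) (suc (suc i)) eq   = at-substTs θ ts (suc i) eq

∈-⊢-inShield : ∀ {H C} (G Q : Literal) → G ∈ H → Q ∈ H → H ⊢ C →
               ∀ (i j : ℕ) {x : Term} →
               args Q at i ≡ just x → args G at j ≡ just x →
               InShield C (sname G) (sname Q) i j
∈-⊢-inShield (lit gs gr gts) (lit qs qr qts) G∈H Q∈H (θ , Hθ⊆C) i j {x} Qi Gj =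
  substL θ (lit gs gr gts) , substL θ (lit qs qr qts) , substT θ x ,
  Hθ⊆C G∈H , Hθ⊆C Q∈H , refl , refl ,
  at-substTs θ gts j Gj , at-substTs θ qts i Qi

lemma6 : (E : Clause → Set) → (∀ C → E C → Straight C) →
         (H : Clause) (G : Literal) → Guard H G → H ⊢ˢ E →
         ∀ (Q : Literal) → Q ∈ H → ∀ (i j : ℕ) (x : Term) →
         args Q at i ≡ just x → args G at j ≡ just x →
         InShieldˢ E (sname G) (sname Q) i j
lemma6 E _ H G guard H⊢E Q Q∈H i j x Qi Gj C C∈E =
  ∈-⊢-inShield G Q (proj₁ guard) Q∈H (H⊢E C C∈E) i j Qi Gj
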